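{- Let $n\ge1$ and $1\le m\le\lceil n/2\rceil$. The indices $0\le i<3^n$ with $m(i)=m$ form two contiguous blocks of length $3^{n-m}$ each (those whose $n$-digit ternary representation begins with $m-1$ ones followed by $0$, respectively by $2$), and each of these blocks, read in order, is the concatenation of $3^{m-1}$ copies of the list $C_{n+1-2m}$. Equivalently, $C_n(i)=C_{n+1-2m}\bigl(i \bmod 3^{n+1-2m}\bigr)$ whenever $m(i)=m$.
   Context: The unit weight-$3$ Stern–Brocot sequences $SB_n$ ($n\ge0$): $SB_0=(\frac{0}{1},\frac{1}{1})$, and $SB_{n+1}$ is obtained from $SB_n$ by keeping all its terms in order and inserting, between each pair of consecutive terms $\frac{p}{q},\frac{r}{s}$ (in lowest terms, positive denominators), the two fractions $\frac{2p+r}{2q+s}$ and $\frac{p+2r}{q+2s}$, each reduced to lowest terms, in this order. $SB_n$ has $3^n+1$ terms, indexed from $0$. For $0\le i<3^n$, $C_n(i)=qr-ps$ where $\frac{p}{q}$ and $\frac{r}{s}$ are the $i$-th and $(i+1)$-th terms of $SB_n$ in lowest terms with positive denominators; $C_n=(C_n(0),\dots,C_n(3^n-1))$. Middleness: write $i$ in base $3$ with exactly $n$ digits $d_1d_2\cdots d_n$ (leading zeros allowed, $d_1$ most significant); $m(i)$ is the least $t\ge1$ with $d_t\in\{0,2\}$. -}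

module Defs where

open import Data.Nat as ℕ using (ℕ; zero; suc; _+_; _*_; _∸_; _^_; _%_; _/_)
open import Data.Integer as ℤ using (ℤ)
open import Data.Rational as ℚ using (ℚ; ↥_; ↧_; ↧ₙ_; 0ℚ)
open import Data.List using (List; []; _∷_)
open import Data.Product using (_×_)
open import Data.Sum using (_⊎_)
open import Relation.Binary.PropositionalEquality using (_≡_)
open import Data.Nat.Properties using (m^n≢0)

_mod3^_ : ℕ → ℕ → ℕ
i mod3^ k = _%_ i (3 ^ k) {{m^n≢0 3 k}}

-- The two inserted fractions between p/q and r/s (automatically reduced by ℚ._/_).
-- Denominators are written as  s + 2q  with s = ↧ₙ b = suc _, so NonZero is found.
ins₁ : ℚ → ℚ → ℚ
ins₁ a b = ((ℤ.+ 2) ℤ.* (↥ a) ℤ.+ ↥ b) ℚ./ (↧ₙ b + 2 * ↧ₙ a)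

ins₂ : ℚ → ℚ → ℚ
ins₂ a b = (↥ a ℤ.+ (ℤ.+ 2) ℤ.* (↥ b)) ℚ./ (↧ₙ a + 2 * ↧ₙ b)

refine : List ℚ → List ℚ
refine [] = []
refine (x ∷ []) = x ∷ []
refine (x ∷ y ∷ rest) = x ∷ ins₁ x y ∷ ins₂ x y ∷ refine (y ∷ rest)

SB : ℕ → List ℚ
SB zero = 0ℚ ∷ ℚ.1ℚ ∷ []
SB (suc n) = refine (SB n)

-- i-th entry of a list (default 0 out of range; only used in range)
nth : List ℚ → ℕ → ℚ
nth [] _ = 0ℚ
nth (x ∷ _) zero = x
nth (_ ∷ xs) (suc i) = nth xs i

C : ℕ → ℕ → ℤ
C n i = (↧ a) ℤ.* (↥ b) ℤ.- (↥ a) ℤ.* (↧ b)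
  where
  a = nth (SB n) i
  b = nth (SB n) (suc i)

-- t-th base-3 digit (t = 1 most significant) of the n-digit representation of i
digit : ℕ → ℕ → ℕ → ℕ
digit n i t = (_/_ i (3 ^ (n ∸ t)) {{m^n≢0 3 (n ∸ t)}}) % 3

-- Middle n i m  :⇔  m(i) = m, i.e. m is the least t ≥ 1 with d_t ∈ {0,2}
Middle : ℕ → ℕ → ℕ → Set
Middle n i m =
  (1 ℕ.≤ m) × (m ℕ.≤ n) × (digit n i m ≡ 0 ⊎ digit n i m ≡ 2) ×
  (∀ t → 1 ℕ.≤ t → t ℕ.< m → digit n i t ≡ 1)

ones : ℕ → ℕ
ones zero = 0
ones (suc k) = 3 * ones k + 1

-- first index of the block whose n-digit ternary expansion starts 1^(m-1) d
blockStart : ℕ → ℕ → ℕ → ℕ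
blockStart n m d = (3 * ones (m ∸ 1) + d) * 3 ^ (n ∸ m)

{-# OPTIONS --safe #-}
module Submission where

-- Write fractions as integer vectors (numerator, denominator). Each consecutive pair (a, b) of SB_n
-- has either the form a = x, b = 3^j z − x or the form a = u, b = u + 3^e w, with
-- det(x, z) = det(u, w) = 1, so that C = 3^j resp. 3^e. Inserting the two new fractions splits (a, b)
-- into three pairs whose forms depend only on the form of (a, b) and on the position d ∈ {0, 1, 2}:
-- the first form with exponent j passes to exponent j + 1 if d = 1 and to the second form with
-- exponent j otherwise, while the second form loses one power of 3 (with exponent 0 both forms say
-- the same). Hence C_n(i) is the output of an automaton run on the ternary digits of i. When
-- m(i) = m, the m − 1 leading ones lead to the first form with exponent m − 1, the digit 0 or 2 to
-- the second form with exponent m − 1, and any m − 1 further digits back to the initial state; the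
-- remaining n + 1 − 2m digits are then processed exactly as for C_{n+1−2m}.

open import Defs
open import Data.Nat using (ℕ; zero; suc; NonZero; z≤n; s≤s; ⌈_/2⌉)
open import Data.Integer as ℤ using (ℤ; +_; 1ℤ)
open import Data.Rational as ℚ using (ℚ; ↥_; ↧_; ↧ₙ_; 0ℚ; 1ℚ)
open import Data.List using (List; []; _∷_; length)
open import Data.Product using (_×_; _,_; proj₁; proj₂; ∃-syntax)
open import Data.Sum using (_⊎_; inj₁; inj₂; [_,_])
import Data.Sum as Sum
open import Function.Bundles using (_⇔_; mk⇔; Equivalence)
open import Relation.Binary.PropositionalEquality
  using (_≡_; refl; sym; trans; cong; cong₂; subst; subst₂; module ≡-Reasoning)

Is0or2 : ℕ → Set
Is0or2 d = d ≡ 0 ⊎ d ≡ 2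

module _ where
  open import Data.Nat using (_+_; _*_; _∸_; _^_; _/_; _%_; _≤_; _<_)
  open import Data.Nat.Properties
  open import Data.Nat.DivMod
  open import Data.Nat.Divisibility using (divides; divides-refl)

  [m*n+o]/n≡m : ∀ m n o .{{_ : NonZero n}} → o < n → (m * n + o) / n ≡ m
  [m*n+o]/n≡m m n o o<n = begin
    (m * n + o) / n ≡⟨ +-distrib-/-∣ˡ o (divides-refl m) ⟩
    m * n / n + o / n ≡⟨ cong₂ _+_ (m*n/n≡m m n) (m<n⇒m/n≡0 o<n) ⟩
    m + 0 ≡⟨ +-identityʳ m ⟩
    m ∎
    where open ≡-Reasoning

  [m*n+o]%n≡o : ∀ m n o .{{_ : NonZero n}} → o < n → (m * n + o) % n ≡ o
  [m*n+o]%n≡o m n o o<n = trans (%-congˡ (+-comm (m * n) o)) (trans ([m+kn]%n≡m%n o m n) (m<n⇒m%n≡m o<n))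

  [3*m+o]/3≡m : ∀ m o → o < 3 → (3 * m + o) / 3 ≡ m
  [3*m+o]/3≡m m o o<3 = trans (/-congˡ (cong (_+ o) (*-comm 3 m))) ([m*n+o]/n≡m m 3 o o<3)

  [3*m+o]%3≡o : ∀ m o → o < 3 → (3 * m + o) % 3 ≡ o
  [3*m+o]%3≡o m o o<3 = trans (%-congˡ (cong (_+ o) (*-comm 3 m))) ([m*n+o]%n≡o m 3 o o<3)

  m≡m/n*n+m%n : ∀ m n .{{_ : NonZero n}} → m ≡ m / n * n + m % n
  m≡m/n*n+m%n m n = trans (m≡m%n+[m/n]*n m n) (+-comm (m % n) (m / n * n))

  m*n+o<p*n : ∀ {m n o p} → m < p → o < n → m * n + o < p * n
  m*n+o<p*n {m} {n} {o} {p} m<p o<n = begin-strict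
    m * n + o <⟨ +-monoʳ-< (m * n) o<n ⟩
    m * n + n ≡⟨ +-comm (m * n) n ⟩
    suc m * n ≤⟨ *-monoˡ-≤ n m<p ⟩
    p * n ∎
    where open ≤-Reasoning

  3*m+o<3*n : ∀ {m n o} → m < n → o < 3 → 3 * m + o < 3 * n
  3*m+o<3*n {m} {n} {o} m<n o<3 = subst₂ _<_ (cong (_+ o) (*-comm m 3)) (*-comm n 3) (m*n+o<p*n m<n o<3)

  Is0or2⇒<3 : ∀ {d} → Is0or2 d → d < 3
  Is0or2⇒<3 (inj₁ refl) = s≤s z≤n
  Is0or2⇒<3 (inj₂ refl) = s≤s (s≤s (s≤s z≤n))

  _div3^_ : ℕ → ℕ → ℕ
  i div3^ k = _/_ i (3 ^ k) {{m^n≢0 3 k}}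

  m≡m/3^k*3^k+m%3^k : ∀ k m → m ≡ m div3^ k * 3 ^ k + m mod3^ k
  m≡m/3^k*3^k+m%3^k k m = m≡m/n*n+m%n m (3 ^ k) {{m^n≢0 3 k}}

  3^[b+a]≡3^a*3^b : ∀ a b → 3 ^ (b + a) ≡ 3 ^ a * 3 ^ b
  3^[b+a]≡3^a*3^b a b = trans (^-distribˡ-+-* 3 b a) (*-comm (3 ^ b) (3 ^ a))

  m*3^b+o<3^[b+a] : ∀ a b {m o} → m < 3 ^ a → o < 3 ^ b → m * 3 ^ b + o < 3 ^ (b + a)
  m*3^b+o<3^[b+a] a b m<3^a o<3^b =
    subst (_ <_) (sym (3^[b+a]≡3^a*3^b a b)) (m*n+o<p*n m<3^a o<3^b)

  m<3^[b+a]⇒m/3^b<3^a : ∀ a b {m} → m < 3 ^ (b + a) → m div3^ b < 3 ^ a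
  m<3^[b+a]⇒m/3^b<3^a a b m< = m<n*o⇒m/o<n {{m^n≢0 3 b}} (subst (_ <_) (3^[b+a]≡3^a*3^b a b) m<)

  m/3^a/3^b≡m/3^[a+b] : ∀ m a b → (m div3^ a) div3^ b ≡ m div3^ (a + b)
  m/3^a/3^b≡m/3^[a+b] m a b =
    trans (m/n/o≡m/[n*o] m (3 ^ a) (3 ^ b) {{m^n≢0 3 a}} {{m^n≢0 3 b}} {{nonZero}})
          (/-congʳ {{nonZero}} {{m^n≢0 3 (a + b)}} (sym (^-distribˡ-+-* 3 a b)))
    where
    nonZero : NonZero (3 ^ a * 3 ^ b)
    nonZero = subst NonZero (^-distribˡ-+-* 3 a b) (m^n≢0 3 (a + b))

  m%3^[b+a]%3^b≡m%3^b : ∀ m a b → (m mod3^ (b + a)) mod3^ b ≡ m mod3^ b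
  m%3^[b+a]%3^b≡m%3^b m a b = m∣n⇒o%n%m≡o%m (3 ^ b) (3 ^ (b + a)) m
    {{m^n≢0 3 b}} {{m^n≢0 3 (b + a)}} (divides (3 ^ a) (3^[b+a]≡3^a*3^b a b))

  digit-low : ∀ n k i t → k ≤ n → t ≤ k → digit n i t ≡ digit k (i div3^ (n ∸ k)) t
  digit-low n k i t k≤n t≤k = trans (cong (λ e → (i div3^ e) % 3) n∸t≡)
                                    (cong (_% 3) (sym (m/3^a/3^b≡m/3^[a+b] i (n ∸ k) (k ∸ t))))
    where
    n∸t≡ : n ∸ t ≡ (n ∸ k) + (k ∸ t)
    n∸t≡ = trans (cong (_∸ t) (sym (m∸n+n≡m k≤n))) (+-∸-assoc (n ∸ k) t≤k)

  digit-suc : ∀ k i t → t ≤ k → digit (suc k) i t ≡ digit k (i / 3) t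
  digit-suc k i t t≤k = trans (digit-low (suc k) k i t (n≤1+n k) t≤k)
                              (cong (λ e → digit k (i div3^ e) t) (m+n∸n≡m 1 k))

  digit-last : ∀ k i → digit k i k ≡ i % 3
  digit-last k i = trans (cong (λ e → (i div3^ e) % 3) (n∸n≡0 k)) (cong (_% 3) (n/1≡n i))

  ones<3^ : ∀ k → ones k < 3 ^ k
  ones<3^ zero = s≤s z≤n
  ones<3^ (suc k) = 3*m+o<3*n (ones<3^ k) (s≤s (s≤s z≤n))

  ones[1+k]/3≡ones[k] : ∀ k → ones (suc k) / 3 ≡ ones k
  ones[1+k]/3≡ones[k] k = [3*m+o]/3≡m (ones k) 1 (s≤s (s≤s z≤n))

  digit-ones : ∀ k t → 1 ≤ t → t ≤ k → digit k (ones k) t ≡ 1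
  digit-ones zero (suc t) _ ()
  digit-ones (suc k) t 1≤t t≤1+k with m≤n⇒m<n∨m≡n t≤1+k
  ... | inj₁ t<1+k = begin
    digit (suc k) (ones (suc k)) t ≡⟨ digit-suc k (ones (suc k)) t (m<1+n⇒m≤n t<1+k) ⟩
    digit k (ones (suc k) / 3) t ≡⟨ cong (λ y → digit k y t) (ones[1+k]/3≡ones[k] k) ⟩
    digit k (ones k) t ≡⟨ digit-ones k t 1≤t (m<1+n⇒m≤n t<1+k) ⟩
    1 ∎
    where open ≡-Reasoning
  ... | inj₂ refl = trans (digit-last (suc k) (ones (suc k))) ([3*m+o]%3≡o (ones k) 1 (s≤s (s≤s z≤n)))

  digits-one⇒ones : ∀ k y → y < 3 ^ k → (∀ t → 1 ≤ t → t ≤ k → digit k y t ≡ 1) → y ≡ ones k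
  digits-one⇒ones zero zero _ _ = refl
  digits-one⇒ones zero (suc y) (s≤s ()) _
  digits-one⇒ones (suc k) y y< digits-one = begin
    y ≡⟨ m≡m/n*n+m%n y 3 ⟩
    y / 3 * 3 + y % 3 ≡⟨ cong₂ (λ q r → q * 3 + r) high low ⟩
    ones k * 3 + 1 ≡⟨ cong (_+ 1) (*-comm (ones k) 3) ⟩
    ones (suc k) ∎
    where
    open ≡-Reasoning
    high : y / 3 ≡ ones k
    high = digits-one⇒ones k (y / 3) (m<3^[b+a]⇒m/3^b<3^a k 1 y<)
      (λ t 1≤t t≤k → trans (sym (digit-suc k y t t≤k)) (digits-one t 1≤t (m≤n⇒m≤1+n t≤k)))
    low : y % 3 ≡ 1
    low = trans (sym (digit-last (suc k) y)) (digits-one (suc k) (s≤s z≤n) ≤-refl)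

  Middle-low : ∀ n m i → m ≤ n → Middle n i m ⇔ Middle m (i div3^ (n ∸ m)) m
  Middle-low n m i m≤n = mk⇔
    (λ (1≤m , _ , end , lead) → 1≤m , ≤-refl , subst Is0or2 last-digit≡ end ,
       λ t 1≤t t<m → trans (sym (digit-low n m i t m≤n (<⇒≤ t<m))) (lead t 1≤t t<m))
    (λ (1≤m , _ , end , lead) → 1≤m , m≤n , subst Is0or2 (sym last-digit≡) end ,
       λ t 1≤t t<m → trans (digit-low n m i t m≤n (<⇒≤ t<m)) (lead t 1≤t t<m))
    where
    last-digit≡ : digit n i m ≡ digit m (i div3^ (n ∸ m)) m
    last-digit≡ = digit-low n m i m m≤n ≤-refl

  Middle-leading : ∀ h d → Is0or2 d → Middle (suc h) (3 * ones h + d) (suc h)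
  Middle-leading h d end = s≤s z≤n , ≤-refl , subst Is0or2 (sym last) end , lead
    where
    d<3 = Is0or2⇒<3 end
    last : digit (suc h) (3 * ones h + d) (suc h) ≡ d
    last = trans (digit-last (suc h) _) ([3*m+o]%3≡o (ones h) d d<3)
    lead : ∀ t → 1 ≤ t → t < suc h → digit (suc h) (3 * ones h + d) t ≡ 1
    lead t 1≤t t<1+h = begin
      digit (suc h) (3 * ones h + d) t ≡⟨ digit-suc h _ t (m<1+n⇒m≤n t<1+h) ⟩
      digit h ((3 * ones h + d) / 3) t ≡⟨ cong (λ y → digit h y t) ([3*m+o]/3≡m (ones h) d d<3) ⟩
      digit h (ones h) t ≡⟨ digit-ones h t 1≤t (m<1+n⇒m≤n t<1+h) ⟩
      1 ∎
      where open ≡-Reasoning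

  Middle-top⇔ : ∀ h y → y < 3 ^ suc h →
    Middle (suc h) y (suc h) ⇔ (y ≡ 3 * ones h + 0 ⊎ y ≡ 3 * ones h + 2)
  Middle-top⇔ h y y< = mk⇔
    (λ (_ , _ , end , lead) → Sum.map (leading lead 0) (leading lead 2) end)
    [ (λ { refl → Middle-leading h 0 (inj₁ refl) }) , (λ { refl → Middle-leading h 2 (inj₂ refl) }) ]
    where
    leading : (∀ t → 1 ≤ t → t < suc h → digit (suc h) y t ≡ 1) →
              ∀ d → digit (suc h) y (suc h) ≡ d → y ≡ 3 * ones h + d
    leading lead d last = begin
      y ≡⟨ m≡m/n*n+m%n y 3 ⟩
      y / 3 * 3 + y % 3 ≡⟨ cong₂ (λ q r → q * 3 + r) high (trans (sym (digit-last (suc h) y)) last) ⟩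
      ones h * 3 + d ≡⟨ cong (_+ d) (*-comm (ones h) 3) ⟩
      3 * ones h + d ∎
      where
      open ≡-Reasoning
      high : y / 3 ≡ ones h
      high = digits-one⇒ones h (y / 3) (m<3^[b+a]⇒m/3^b<3^a h 1 y<)
        (λ t 1≤t t≤h → trans (sym (digit-suc h y t t≤h)) (lead t 1≤t (s≤s t≤h)))

  Middle⇔inBlock : ∀ n h i → suc h ≤ n → i < 3 ^ n →
    Middle n i (suc h) ⇔
      (∃[ j ] (j < 3 ^ (n ∸ suc h) × (i ≡ blockStart n (suc h) 0 + j ⊎ i ≡ blockStart n (suc h) 2 + j)))
  Middle⇔inBlock n h i 1+h≤n i< = mk⇔
    (λ mid → i mod3^ E , m%n<n i (3 ^ E) {{m^n≢0 3 E}} ,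
       Sum.map (toBlock 0) (toBlock 2)
         (Equivalence.to (Middle-top⇔ h (i div3^ E) prefix<) (Equivalence.to (Middle-low n (suc h) i 1+h≤n) mid)))
    (λ (j , j< , inBlock) → Equivalence.from (Middle-low n (suc h) i 1+h≤n)
       (Equivalence.from (Middle-top⇔ h (i div3^ E) prefix<) (Sum.map (fromBlock j j< 0) (fromBlock j j< 2) inBlock)))
    where
    E = n ∸ suc h
    prefix< : i div3^ E < 3 ^ suc h
    prefix< = m<3^[b+a]⇒m/3^b<3^a (suc h) E (subst (λ e → i < 3 ^ e) (sym (m∸n+n≡m 1+h≤n)) i<)
    toBlock : ∀ d → i div3^ E ≡ 3 * ones h + d → i ≡ blockStart n (suc h) d + i mod3^ E
    toBlock d eq = trans (m≡m/3^k*3^k+m%3^k E i) (cong (λ q → q * 3 ^ E + i mod3^ E) eq)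
    fromBlock : ∀ j → j < 3 ^ E → ∀ d → i ≡ blockStart n (suc h) d + j → i div3^ E ≡ 3 * ones h + d
    fromBlock j j< d eq = trans (cong (_div3^ E) eq) ([m*n+o]/n≡m (3 * ones h + d) (3 ^ E) j {{m^n≢0 3 E}} j<)

  foldDigits : {S : Set} → (S → ℕ → S) → S → ℕ → ℕ → S
  foldDigits f s zero i = s
  foldDigits f s (suc n) i = f (foldDigits f s n (i / 3)) (i % 3)

  foldDigits-split : ∀ {S : Set} (f : S → ℕ → S) s a b x y → y < 3 ^ b →
    foldDigits f s (b + a) (x * 3 ^ b + y) ≡ foldDigits f (foldDigits f s a x) b y
  foldDigits-split f s a zero x zero _ = cong (foldDigits f s a) (trans (+-identityʳ _) (*-identityʳ x))
  foldDigits-split f s a zero x (suc y) (s≤s ())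
  foldDigits-split f s a (suc b) x y y< = cong₂ f
      (trans (cong (foldDigits f s (b + a)) quotient) (foldDigits-split f s a b x (y / 3) (m<3^[b+a]⇒m/3^b<3^a b 1 y<)))
      remainder
    where
    x*3^[1+b]≡ : x * 3 ^ suc b ≡ x * 3 ^ b * 3
    x*3^[1+b]≡ = trans (cong (x *_) (*-comm 3 (3 ^ b))) (sym (*-assoc x (3 ^ b) 3))
    quotient : (x * 3 ^ suc b + y) / 3 ≡ x * 3 ^ b + y / 3
    quotient = trans (/-congˡ (cong (_+ y) x*3^[1+b]≡))
      (trans (+-distrib-/-∣ˡ y (divides-refl (x * 3 ^ b))) (cong (_+ y / 3) (m*n/n≡m (x * 3 ^ b) 3)))
    remainder : (x * 3 ^ suc b + y) % 3 ≡ y % 3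
    remainder = trans (%-congˡ (trans (cong (_+ y) x*3^[1+b]≡) (+-comm (x * 3 ^ b * 3) y)))
      ([m+kn]%n≡m%n y (x * 3 ^ b) 3)

module _ where
  open import Data.Integer using (_+_; _*_; _-_; -_; _^_; ∣_∣)
  open import Data.Integer.Properties using (abs-*; *-cancelʳ-≡; *-identityʳ; *-comm; +-comm; pos-*)
  open import Data.Integer.Tactic.RingSolver using (solve-∀)
  open import Data.Rational.Properties using (↥-/; ↧-/)
  import Data.Nat.Properties as ℕₚ
  open import Data.Nat.Divisibility using (_∣_; divides; ∣-antisym)
  open import Data.Nat.GCD using (gcd; gcd-greatest)

  ∣-of-multiple : ∀ {c X Y} → X ≡ + c * Y → c ∣ ∣ X ∣
  ∣-of-multiple {c} {X} {Y} X≡cY =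
    divides ∣ Y ∣ (trans (cong ∣_∣ X≡cY) (trans (abs-* (+ c) Y) (ℕₚ.*-comm c ∣ Y ∣)))

  -- Q u − P v = 1 is a Bézout certificate that P and Q are coprime, so c is the gcd of N and D.
  /-lowest-terms : ∀ N D c .{{_ : NonZero D}} {{_ : NonZero c}} {P Q u v : ℤ} →
    N ≡ + c * P → + D ≡ + c * Q → Q * u - P * v ≡ 1ℤ → ↥ (N ℚ./ D) ≡ P × ↧ (N ℚ./ D) ≡ Q
  /-lowest-terms N D c {P} {Q} {u} {v} N≡cP D≡cQ bezout = cancel (↥-/ N D) N≡cP , cancel (↧-/ N D) D≡cQ
    where
    r = N ℚ./ D
    g = gcd ∣ N ∣ D
    c≡g*k : + c ≡ + g * (↧ r * u - ↥ r * v)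
    c≡g*k = begin
      + c ≡⟨ sym (trans (cong (+ c *_) bezout) (*-identityʳ (+ c))) ⟩
      + c * (Q * u - P * v) ≡⟨ distrib (+ c) Q u P v ⟩
      (+ c * Q) * u - (+ c * P) * v ≡⟨ cong₂ (λ s t → s * u - t * v) (sym D≡cQ) (sym N≡cP) ⟩
      + D * u - N * v ≡⟨ cong₂ (λ s t → s * u - t * v) (sym (↧-/ N D)) (sym (↥-/ N D)) ⟩
      (↧ r * + g) * u - (↥ r * + g) * v ≡⟨ factor (↧ r) (↥ r) (+ g) u v ⟩
      + g * (↧ r * u - ↥ r * v) ∎
      where
      open ≡-Reasoning
      distrib : ∀ c Q u P v → c * (Q * u - P * v) ≡ (c * Q) * u - (c * P) * v
      distrib = solve-∀
      factor : ∀ q p g u v → (q * g) * u - (p * g) * v ≡ g * (q * u - p * v)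
      factor = solve-∀
    g≡c : g ≡ c
    g≡c = ∣-antisym (∣-of-multiple c≡g*k) (gcd-greatest (∣-of-multiple N≡cP) (∣-of-multiple D≡cQ))
    cancel : ∀ {s X Y} → s * + g ≡ X → X ≡ + c * Y → s ≡ Y
    cancel {s} {X} {Y} sg≡X X≡cY = *-cancelʳ-≡ s Y (+ c)
      (trans (subst (λ e → s * + e ≡ X) g≡c sg≡X) (trans X≡cY (*-comm (+ c) Y)))

  ins₁-lowest : ∀ a b c {{_ : NonZero c}} {P Q u v} →
    + 2 * ↥ a + ↥ b ≡ + c * P → + 2 * ↧ a + ↧ b ≡ + c * Q → Q * u - P * v ≡ 1ℤ →
    ↥ ins₁ a b ≡ P × ↧ ins₁ a b ≡ Q
  ins₁-lowest a b c num den =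
    /-lowest-terms _ _ c num (trans (cong (_+_ (↧ b)) (pos-* 2 (↧ₙ a))) (trans (+-comm (↧ b) (+ 2 * ↧ a)) den))

  ins₂-lowest : ∀ a b c {{_ : NonZero c}} {P Q u v} →
    ↥ a + + 2 * ↥ b ≡ + c * P → ↧ a + + 2 * ↧ b ≡ + c * Q → Q * u - P * v ≡ 1ℤ →
    ↥ ins₂ a b ≡ P × ↧ ins₂ a b ≡ Q
  ins₂-lowest a b c num den = /-lowest-terms _ _ c num (trans (cong (_+_ (↧ a)) (pos-* 2 (↧ₙ b))) den)

  det : ℚ → ℚ → ℤ
  det a b = ↧ a * ↥ b - ↥ a * ↧ b

  det-shearˡ : ∀ xp xq zp zq s → (xq + s * zq) * zp - (xp + s * zp) * zq ≡ xq * zp - xp * zq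
  det-shearˡ = solve-∀

  det-shearʳ : ∀ xp xq zp zq s → xq * (s * xp + zp) - xp * (s * xq + zq) ≡ xq * zp - xp * zq
  det-shearʳ = solve-∀

  det-reflect : ∀ xp xq zp zq s → (s * zq - xq) * (- zp) - (s * zp - xp) * (- zq) ≡ xq * zp - xp * zq
  det-reflect = solve-∀

  record PlusForm (j : ℕ) (a b : ℚ) : Set where
    field
      xp xq zp zq : ℤ
      ↥a : ↥ a ≡ xp
      ↧a : ↧ a ≡ xq
      ↥b : ↥ b ≡ (+ 3) ^ j * zp - xp
      ↧b : ↧ b ≡ (+ 3) ^ j * zq - xq
      unimodular : xq * zp - xp * zq ≡ 1ℤ

  record MinusForm (e : ℕ) (a b : ℚ) : Set where
    field
      up uq wp wq : ℤ
      ↥a : ↥ a ≡ up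
      ↧a : ↧ a ≡ uq
      ↥b : ↥ b ≡ up + (+ 3) ^ e * wp
      ↧b : ↧ b ≡ uq + (+ 3) ^ e * wq
      unimodular : uq * wp - up * wq ≡ 1ℤ

  data Shape : Set where
    plus : ℕ → Shape
    minus : ℕ → Shape

  -- minus k stands for the exponent 1 + k; exponent 0 is covered by plus 0.
  exponent : Shape → ℕ
  exponent (plus j) = j
  exponent (minus k) = suc k

  minusShape : ℕ → Shape
  minusShape zero = plus zero
  minusShape (suc k) = minus k

  Realises : Shape → ℚ × ℚ → Set
  Realises (plus j) (a , b) = PlusForm j a b
  Realises (minus k) (a , b) = MinusForm (suc k) a b

  child : Shape → ℕ → Shape
  child (plus j) 1 = plus (suc j)
  child (plus j) _ = minusShape j
  child (minus k) _ = minusShape k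

  subpair : ℚ × ℚ → ℕ → ℚ × ℚ
  subpair (a , b) 0 = a , ins₁ a b
  subpair (a , b) 1 = ins₁ a b , ins₂ a b
  subpair (a , b) _ = ins₂ a b , b

  realises-minusShape : ∀ e {a b} → MinusForm e a b → Realises (minusShape e) (a , b)
  realises-minusShape (suc k) f = f
  realises-minusShape zero f = record
    { xp = up ; xq = uq ; zp = + 2 * up + wp ; zq = + 2 * uq + wq
    ; ↥a = ↥a ; ↧a = ↧a ; ↥b = trans ↥b (b≡ up wp) ; ↧b = trans ↧b (b≡ uq wq)
    ; unimodular = trans (det-shearʳ up uq wp wq (+ 2)) unimodular }
    where
    open MinusForm f
    b≡ : ∀ u w → u + + 1 * w ≡ + 1 * (+ 2 * u + w) - u
    b≡ = solve-∀

  module PlusForm-children {j a b} (f : PlusForm j a b) where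
    open PlusForm f
    T = (+ 3) ^ j

    private
      ins₁≡ : ∀ x z T → + 2 * x + (T * z - x) ≡ + 1 * (x + T * z)
      ins₁≡ = solve-∀
      ins₂≡ : ∀ x z T → x + + 2 * (T * z - x) ≡ + 1 * (+ 2 * T * z - x)
      ins₂≡ = solve-∀

    ins₁-components : ↥ ins₁ a b ≡ xp + T * zp × ↧ ins₁ a b ≡ xq + T * zq
    ins₁-components = ins₁-lowest a b 1
      (trans (cong₂ (λ s t → + 2 * s + t) ↥a ↥b) (ins₁≡ xp zp T))
      (trans (cong₂ (λ s t → + 2 * s + t) ↧a ↧b) (ins₁≡ xq zq T))
      (trans (det-shearˡ xp xq zp zq T) unimodular)

    ins₂-components : ↥ ins₂ a b ≡ + 2 * T * zp - xp × ↧ ins₂ a b ≡ + 2 * T * zq - xq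
    ins₂-components = ins₂-lowest a b 1
      (trans (cong₂ (λ s t → s + + 2 * t) ↥a ↥b) (ins₂≡ xp zp T))
      (trans (cong₂ (λ s t → s + + 2 * t) ↧a ↧b) (ins₂≡ xq zq T))
      (trans (det-reflect xp xq zp zq (+ 2 * T)) unimodular)

    left : MinusForm j a (ins₁ a b)
    left = record { up = xp ; uq = xq ; wp = zp ; wq = zq ; ↥a = ↥a ; ↧a = ↧a
      ; ↥b = proj₁ ins₁-components ; ↧b = proj₂ ins₁-components ; unimodular = unimodular }

    middle : PlusForm (suc j) (ins₁ a b) (ins₂ a b)
    middle = record { xp = xp + T * zp ; xq = xq + T * zq ; zp = zp ; zq = zq
      ; ↥a = proj₁ ins₁-components ; ↧a = proj₂ ins₁-components
      ; ↥b = trans (proj₁ ins₂-components) (ins₂≡3T-ins₁ xp zp T)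
      ; ↧b = trans (proj₂ ins₂-components) (ins₂≡3T-ins₁ xq zq T)
      ; unimodular = trans (det-shearˡ xp xq zp zq T) unimodular }
      where
      ins₂≡3T-ins₁ : ∀ x z T → + 2 * T * z - x ≡ + 3 * T * z - (x + T * z)
      ins₂≡3T-ins₁ = solve-∀

    right : MinusForm j (ins₂ a b) b
    right = record { up = + 2 * T * zp - xp ; uq = + 2 * T * zq - xq ; wp = - zp ; wq = - zq
      ; ↥a = proj₁ ins₂-components ; ↧a = proj₂ ins₂-components
      ; ↥b = trans ↥b (b≡ins₂-T xp zp T) ; ↧b = trans ↧b (b≡ins₂-T xq zq T)
      ; unimodular = trans (det-reflect xp xq zp zq (+ 2 * T)) unimodular }
      where
      b≡ins₂-T : ∀ x z T → T * z - x ≡ (+ 2 * T * z - x) + T * (- z)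
      b≡ins₂-T = solve-∀

  module MinusForm-children {k a b} (f : MinusForm (suc k) a b) where
    open MinusForm f
    T = (+ 3) ^ k

    private
      ins₁≡ : ∀ u w T → + 2 * u + (u + + 3 * T * w) ≡ + 3 * (u + T * w)
      ins₁≡ = solve-∀
      ins₂≡ : ∀ u w T → u + + 2 * (u + + 3 * T * w) ≡ + 3 * (u + + 2 * T * w)
      ins₂≡ = solve-∀
      ins₂≡ins₁+T : ∀ u w T → u + + 2 * T * w ≡ (u + T * w) + T * w
      ins₂≡ins₁+T = solve-∀
      b≡ins₂+T : ∀ u w T → u + + 3 * T * w ≡ (u + + 2 * T * w) + T * w
      b≡ins₂+T = solve-∀

    ins₁-components : ↥ ins₁ a b ≡ up + T * wp × ↧ ins₁ a b ≡ uq + T * wq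
    ins₁-components = ins₁-lowest a b 3
      (trans (cong₂ (λ s t → + 2 * s + t) ↥a ↥b) (ins₁≡ up wp T))
      (trans (cong₂ (λ s t → + 2 * s + t) ↧a ↧b) (ins₁≡ uq wq T))
      (trans (det-shearˡ up uq wp wq T) unimodular)

    ins₂-components : ↥ ins₂ a b ≡ up + + 2 * T * wp × ↧ ins₂ a b ≡ uq + + 2 * T * wq
    ins₂-components = ins₂-lowest a b 3
      (trans (cong₂ (λ s t → s + + 2 * t) ↥a ↥b) (ins₂≡ up wp T))
      (trans (cong₂ (λ s t → s + + 2 * t) ↧a ↧b) (ins₂≡ uq wq T))
      (trans (det-shearˡ up uq wp wq (+ 2 * T)) unimodular)

    left : MinusForm k a (ins₁ a b)
    left = record { up = up ; uq = uq ; wp = wp ; wq = wq ; ↥a = ↥a ; ↧a = ↧a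
      ; ↥b = proj₁ ins₁-components ; ↧b = proj₂ ins₁-components ; unimodular = unimodular }

    middle : MinusForm k (ins₁ a b) (ins₂ a b)
    middle = record { up = up + T * wp ; uq = uq + T * wq ; wp = wp ; wq = wq
      ; ↥a = proj₁ ins₁-components ; ↧a = proj₂ ins₁-components
      ; ↥b = trans (proj₁ ins₂-components) (ins₂≡ins₁+T up wp T)
      ; ↧b = trans (proj₂ ins₂-components) (ins₂≡ins₁+T uq wq T)
      ; unimodular = trans (det-shearˡ up uq wp wq T) unimodular }

    right : MinusForm k (ins₂ a b) b
    right = record { up = up + + 2 * T * wp ; uq = uq + + 2 * T * wq ; wp = wp ; wq = wq
      ; ↥a = proj₁ ins₂-components ; ↧a = proj₂ ins₂-components
      ; ↥b = trans ↥b (b≡ins₂+T up wp T) ; ↧b = trans ↧b (b≡ins₂+T uq wq T)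
      ; unimodular = trans (det-shearˡ up uq wp wq (+ 2 * T)) unimodular }

  child-realises : ∀ s p d → Realises s p → Realises (child s d) (subpair p d)
  child-realises (plus j) _ 0 f = realises-minusShape j (PlusForm-children.left f)
  child-realises (plus j) _ 1 f = PlusForm-children.middle f
  child-realises (plus j) _ (suc (suc _)) f = realises-minusShape j (PlusForm-children.right f)
  child-realises (minus k) _ 0 f = realises-minusShape k (MinusForm-children.left f)
  child-realises (minus k) _ 1 f = realises-minusShape k (MinusForm-children.middle f)
  child-realises (minus k) _ (suc (suc _)) f = realises-minusShape k (MinusForm-children.right f)

  det-components : ∀ a b {p q r s} → ↥ a ≡ p → ↧ a ≡ q → ↥ b ≡ r → ↧ b ≡ s → det a b ≡ q * r - p * s
  det-components _ _ refl refl refl refl = refl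

  det-realises : ∀ s {a b} → Realises s (a , b) → det a b ≡ (+ 3) ^ exponent s
  det-realises (plus j) {a} {b} f = begin
    det a b ≡⟨ det-components a b ↥a ↧a ↥b ↧b ⟩
    xq * (T * zp - xp) - xp * (T * zq - xq) ≡⟨ factor xp xq zp zq T ⟩
    T * (xq * zp - xp * zq) ≡⟨ cong (T *_) unimodular ⟩
    T * 1ℤ ≡⟨ *-identityʳ T ⟩
    T ∎
    where
    open PlusForm f
    open ≡-Reasoning
    T = (+ 3) ^ j
    factor : ∀ xp xq zp zq T → xq * (T * zp - xp) - xp * (T * zq - xq) ≡ T * (xq * zp - xp * zq)
    factor = solve-∀
  det-realises (minus k) {a} {b} f = begin
    det a b ≡⟨ det-components a b ↥a ↧a ↥b ↧b ⟩
    uq * (up + T * wp) - up * (uq + T * wq) ≡⟨ factor up uq wp wq T ⟩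
    T * (uq * wp - up * wq) ≡⟨ cong (T *_) unimodular ⟩
    T * 1ℤ ≡⟨ *-identityʳ T ⟩
    T ∎
    where
    open MinusForm f
    open ≡-Reasoning
    T = (+ 3) ^ suc k
    factor : ∀ up uq wp wq T → uq * (up + T * wp) - up * (uq + T * wq) ≡ T * (uq * wp - up * wq)
    factor = solve-∀

  root-realises : Realises (plus 0) (0ℚ , 1ℚ)
  root-realises = record { xp = + 0 ; xq = + 1 ; zp = + 1 ; zq = + 2
    ; ↥a = refl ; ↧a = refl ; ↥b = refl ; ↧b = refl ; unimodular = refl }

module _ where
  open import Data.Nat using (_+_; _*_; _∸_; _^_; _/_; _%_; _≤_; _<_)
  open import Data.Nat.Properties
  open import Data.Nat.DivMod using (m%n<n)
  open import Data.Nat.Tactic.RingSolver using (solve-∀)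

  pairAt : List ℚ → ℕ → ℚ × ℚ
  pairAt L i = nth L i , nth L (suc i)

  length-refine : ∀ L {m} → length L ≡ suc m → length (refine L) ≡ suc (3 * m)
  length-refine (x ∷ []) refl = refl
  length-refine (x ∷ y ∷ L) refl =
    trans (cong (_+_ 3) (length-refine (y ∷ L) refl)) (cong suc (sym (*-suc 3 (length L))))

  length-SB : ∀ n → length (SB n) ≡ suc (3 ^ n)
  length-SB zero = refl
  length-SB (suc n) = length-refine (SB n) (length-SB n)

  head-refine : ∀ x L → nth (refine (x ∷ L)) 0 ≡ x
  head-refine x [] = refl
  head-refine x (y ∷ L) = refl

  pairAt-refine : ∀ L t d → d < 3 → suc t < length L →
    pairAt (refine L) (3 * t + d) ≡ subpair (pairAt L t) d
  pairAt-refine (x ∷ y ∷ L) zero 0 _ _ = refl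
  pairAt-refine (x ∷ y ∷ L) zero 1 _ _ = refl
  pairAt-refine (x ∷ y ∷ L) zero 2 _ _ = cong (ins₂ x y ,_) (head-refine y L)
  pairAt-refine (x ∷ y ∷ L) zero (suc (suc (suc _))) (s≤s (s≤s (s≤s ()))) _
  pairAt-refine (x ∷ y ∷ L) (suc t) d d<3 (s≤s t<) =
    trans (cong (pairAt (refine (x ∷ y ∷ L))) (cong (_+ d) (*-suc 3 t))) (pairAt-refine (y ∷ L) t d d<3 t<)
  pairAt-refine (x ∷ []) _ _ _ (s≤s ())
  pairAt-refine [] _ _ _ ()

  SB-realises : ∀ n i → i < 3 ^ n → Realises (foldDigits child (plus 0) n i) (pairAt (SB n) i)
  SB-realises zero zero _ = root-realises
  SB-realises zero (suc i) (s≤s ())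
  SB-realises (suc n) i i< = subst (Realises _) (sym pairAt-SB)
    (child-realises _ _ (i % 3) (SB-realises n (i / 3) i/3<))
    where
    i/3< : i / 3 < 3 ^ n
    i/3< = m<3^[b+a]⇒m/3^b<3^a n 1 i<
    pairAt-SB : pairAt (SB (suc n)) i ≡ subpair (pairAt (SB n) (i / 3)) (i % 3)
    pairAt-SB = trans (cong (pairAt (refine (SB n))) (trans (m≡m/n*n+m%n i 3) (cong (_+ i % 3) (*-comm (i / 3) 3))))
      (pairAt-refine (SB n) (i / 3) (i % 3) (m%n<n i 3) (subst (suc (i / 3) <_) (sym (length-SB n)) (s≤s i/3<)))

  C≡3^exponent : ∀ n i → i < 3 ^ n → C n i ≡ (+ 3) ℤ.^ exponent (foldDigits child (plus 0) n i)
  C≡3^exponent n i i< = det-realises _ (SB-realises n i i<)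

  C-cong-shape : ∀ n i L j → i < 3 ^ n → j < 3 ^ L →
    foldDigits child (plus 0) n i ≡ foldDigits child (plus 0) L j → C n i ≡ C L j
  C-cong-shape n i L j i< j< same = trans (C≡3^exponent n i i<)
    (trans (cong (λ s → (+ 3) ℤ.^ exponent s) same) (sym (C≡3^exponent L j j<)))

  foldDigits-ones : ∀ k → foldDigits child (plus 0) k (ones k) ≡ plus k
  foldDigits-ones zero = refl
  foldDigits-ones (suc k) = cong₂ child
    (trans (cong (foldDigits child (plus 0) k) (ones[1+k]/3≡ones[k] k)) (foldDigits-ones k))
    ([3*m+o]%3≡o (ones k) 1 (s≤s (s≤s z≤n)))

  foldDigits-leading : ∀ h d → Is0or2 d → foldDigits child (plus 0) (suc h) (3 * ones h + d) ≡ minusShape h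
  foldDigits-leading h d end = begin
    child (foldDigits child (plus 0) h ((3 * ones h + d) / 3)) ((3 * ones h + d) % 3)
      ≡⟨ cong₂ child (cong (foldDigits child (plus 0) h) ([3*m+o]/3≡m (ones h) d d<3)) ([3*m+o]%3≡o (ones h) d d<3) ⟩
    child (foldDigits child (plus 0) h (ones h)) d ≡⟨ cong (λ s → child s d) (foldDigits-ones h) ⟩
    child (plus h) d ≡⟨ child-plus end ⟩
    minusShape h ∎
    where
    open ≡-Reasoning
    d<3 = Is0or2⇒<3 end
    child-plus : ∀ {d} → Is0or2 d → child (plus h) d ≡ minusShape h
    child-plus (inj₁ refl) = refl
    child-plus (inj₂ refl) = refl

  foldDigits-minusShape : ∀ e n k → foldDigits child (minusShape (e + n)) n k ≡ minusShape e
  foldDigits-minusShape e zero k = cong minusShape (+-identityʳ e)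
  foldDigits-minusShape e (suc n) k = cong (λ s → child s (k % 3))
    (trans (cong (λ x → foldDigits child (minusShape x) n (k / 3)) (+-suc e n)) (foldDigits-minusShape (suc e) n (k / 3)))

  blockStart≡ : ∀ E h d → blockStart (E + suc h) (suc h) d ≡ (3 * ones h + d) * 3 ^ E
  blockStart≡ E h d = cong (λ e → (3 * ones h + d) * 3 ^ e) (m+n∸n≡m E (suc h))

  C-block : ∀ L h d c j → Is0or2 d → c < 3 ^ h → j < 3 ^ L →
    C ((L + h) + suc h) (blockStart ((L + h) + suc h) (suc h) d + c * 3 ^ L + j) ≡ C L j
  C-block L h d c j end c< j< = trans (cong (C n) index≡)
    (C-cong-shape n (prefix * 3 ^ (L + h) + tail) L j (m*3^b+o<3^[b+a] (suc h) (L + h) prefix< tail<) j< shape≡)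
    where
    open ≡-Reasoning
    n = (L + h) + suc h
    prefix = 3 * ones h + d
    tail = c * 3 ^ L + j
    prefix< : prefix < 3 ^ suc h
    prefix< = 3*m+o<3*n (ones<3^ h) (Is0or2⇒<3 end)
    tail< : tail < 3 ^ (L + h)
    tail< = m*3^b+o<3^[b+a] h L c< j<
    index≡ : blockStart n (suc h) d + c * 3 ^ L + j ≡ prefix * 3 ^ (L + h) + tail
    index≡ = trans (+-assoc _ (c * 3 ^ L) j) (cong (_+ tail) (blockStart≡ (L + h) h d))
    shape≡ : foldDigits child (plus 0) n (prefix * 3 ^ (L + h) + tail) ≡ foldDigits child (plus 0) L j
    shape≡ = begin
      foldDigits child (plus 0) n (prefix * 3 ^ (L + h) + tail)
        ≡⟨ foldDigits-split child (plus 0) (suc h) (L + h) prefix tail tail< ⟩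
      foldDigits child (foldDigits child (plus 0) (suc h) prefix) (L + h) tail
        ≡⟨ cong (λ s → foldDigits child s (L + h) tail) (foldDigits-leading h d end) ⟩
      foldDigits child (minusShape h) (L + h) (c * 3 ^ L + j)
        ≡⟨ foldDigits-split child (minusShape h) h L c j j< ⟩
      foldDigits child (foldDigits child (minusShape h) h c) L j
        ≡⟨ cong (λ s → foldDigits child s L j) (foldDigits-minusShape 0 h c) ⟩
      foldDigits child (plus 0) L j ∎

  C-middle : ∀ L h i → i < 3 ^ ((L + h) + suc h) → Middle ((L + h) + suc h) i (suc h) →
    C ((L + h) + suc h) i ≡ C L (i mod3^ L)
  C-middle L h i i< mid with Equivalence.to (Middle⇔inBlock ((L + h) + suc h) h i (m≤n+m (suc h) (L + h)) i<) mid
  ... | j' , j'< , inBlock = [ fromBlock 0 (inj₁ refl) , fromBlock 2 (inj₂ refl) ] inBlock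
    where
    n = (L + h) + suc h
    E≡ : n ∸ suc h ≡ L + h
    E≡ = m+n∸n≡m (L + h) (suc h)
    c = j' div3^ L
    j = j' mod3^ L
    fromBlock : ∀ d → Is0or2 d → i ≡ blockStart n (suc h) d + j' → C n i ≡ C L (i mod3^ L)
    fromBlock d end i≡ = begin
      C n i ≡⟨ cong (C n) (trans i≡ (trans (cong (_+_ (blockStart n (suc h) d)) (m≡m/3^k*3^k+m%3^k L j'))
                                              (sym (+-assoc _ (c * 3 ^ L) j)))) ⟩
      C n (blockStart n (suc h) d + c * 3 ^ L + j)
        ≡⟨ C-block L h d c j end (m<3^[b+a]⇒m/3^b<3^a h L (subst (λ e → j' < 3 ^ e) E≡ j'<))
             (m%n<n j' (3 ^ L) {{m^n≢0 3 L}}) ⟩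
      C L j ≡⟨ cong (C L) (trans (cong (_mod3^ L) (sym low≡j')) (m%3^[b+a]%3^b≡m%3^b i h L)) ⟩
      C L (i mod3^ L) ∎
      where
      open ≡-Reasoning
      low≡j' : i mod3^ (L + h) ≡ j'
      low≡j' = trans (cong (i mod3^_) (sym E≡))
        (trans (cong (_mod3^ (n ∸ suc h)) i≡)
          ([m*n+o]%n≡o (3 * ones h + d) (3 ^ (n ∸ suc h)) j' {{m^n≢0 3 (n ∸ suc h)}} j'<))

  m≤⌈n/2⌉⇒m+m≤1+n : ∀ n m → m ≤ ⌈ n /2⌉ → m + m ≤ suc n
  m≤⌈n/2⌉⇒m+m≤1+n zero zero _ = z≤n
  m≤⌈n/2⌉⇒m+m≤1+n (suc zero) zero _ = z≤n
  m≤⌈n/2⌉⇒m+m≤1+n (suc zero) (suc zero) _ = s≤s (s≤s z≤n)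
  m≤⌈n/2⌉⇒m+m≤1+n (suc zero) (suc (suc m)) (s≤s ())
  m≤⌈n/2⌉⇒m+m≤1+n (suc (suc n)) zero _ = z≤n
  m≤⌈n/2⌉⇒m+m≤1+n (suc (suc n)) (suc m) (s≤s m≤) =
    s≤s (subst (_≤ suc (suc n)) (sym (+-suc m m)) (s≤s (m≤⌈n/2⌉⇒m+m≤1+n n m m≤)))

  tail-length : ∀ n h → suc h ≤ ⌈ n /2⌉ → ∃[ L ] (n ≡ (L + h) + suc h)
  tail-length n h 1+h≤ = n ∸ (h + suc h) ,
    sym (trans (+-assoc (n ∸ (h + suc h)) h (suc h)) (m∸n+n≡m (≤-pred (m≤⌈n/2⌉⇒m+m≤1+n n (suc h) 1+h≤))))

  1+n∸2m≡L : ∀ L h → suc ((L + h) + suc h) ∸ 2 * suc h ≡ L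
  1+n∸2m≡L L h = trans (cong (_∸ 2 * suc h) (1+n≡L+2m L h)) (m+n∸n≡m L (2 * suc h))
    where
    1+n≡L+2m : ∀ L h → suc ((L + h) + suc h) ≡ L + 2 * suc h
    1+n≡L+2m = solve-∀

open import Data.Nat using (_+_; _*_; _∸_; _^_; _≤_; _<_)
open import Data.Nat.Properties using (m≤n+m)

theorem21 : ∀ (n m : ℕ) → 1 ≤ n → 1 ≤ m → m ≤ ⌈ n /2⌉ →
    (∀ i → i < 3 ^ n →
       (Middle n i m ⇔ (∃[ j ] (j < 3 ^ (n ∸ m) ×
          (i ≡ blockStart n m 0 + j ⊎ i ≡ blockStart n m 2 + j)))))
  × (∀ d k j → (d ≡ 0 ⊎ d ≡ 2) → k < 3 ^ (m ∸ 1) → j < 3 ^ (suc n ∸ 2 * m) →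
       C n (blockStart n m d + k * 3 ^ (suc n ∸ 2 * m) + j) ≡ C (suc n ∸ 2 * m) j)
  × (∀ i → i < 3 ^ n → Middle n i m →
       C n i ≡ C (suc n ∸ 2 * m) (i mod3^ (suc n ∸ 2 * m)))
theorem21 n zero _ () _
theorem21 n (suc h) _ _ m≤⌈n/2⌉ with tail-length n h m≤⌈n/2⌉
... | L , refl rewrite 1+n∸2m≡L L h =
  (λ i → Middle⇔inBlock n h i (m≤n+m (suc h) (L + h))) , C-block L h , C-middle L h
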